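{- For every prime $p$ there exists $i \ge 1$ such that $X^{(i)}(p)$ is not prime. Equivalently, there is no prime $p$ for which all iterates $X^{(i)}(p)$, $i\ge 1$, are prime.
   Context: For a positive integer $n$, let $\Pi(n)$ denote the sum of the distinct prime divisors of $n$, and let $\mathcal{C}(n)$ denote the sum of all positive divisors of $n$ that are not prime (including $1$ and, when $n$ is not prime, $n$ itself). Define $X(n) = \Pi(n) - \mathcal{C}(n) + n$; in particular $X(p) = 2p-1$ for $p$ prime. For $i\ge1$ let $X^{(i)}$ denote the $i$-fold iterate of $X$. -}

module Defs where

open import Data.Nat as ℕ using (ℕ; zero; suc)
open import Data.Nat.Divisibility using (_∣?_)
open import Data.Nat.Primality using (Prime; prime?)
open import Data.List using (List; filter; map; upTo)
open import Data.Nat.ListAction using (sum)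
open import Data.Empty using (⊥)
open import Data.Integer as ℤ using (ℤ; +_; -[1+_])
open import Relation.Nullary using (¬?)
open import Function using (_∘_)

divisors : ℕ → List ℕ
divisors n = filter (_∣? n) (map suc (upTo n))

Π : ℕ → ℕ
Π n = sum (filter prime? (divisors n))

𝒞 : ℕ → ℕ
𝒞 n = sum (filter (¬? ∘ prime?) (divisors n))

X : ℕ → ℤ
X n = (+ Π n) ℤ.- (+ 𝒞 n) ℤ.+ (+ n)

-- X extended to ℤ so it can be iterated; the value on non-positive
-- integers is irrelevant (such values are never prime). Convention: 0.
Xℤ : ℤ → ℤ
Xℤ (+ zero)    = + 0
Xℤ (+ suc n)   = X (suc n)
Xℤ -[1+ n ]    = + 0

iterate : (ℤ → ℤ) → ℕ → ℤ → ℤ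
iterate f zero    z = z
iterate f (suc i) z = f (iterate f i z)

IsPrimeℤ : ℤ → Set
IsPrimeℤ (+ n)     = Prime n
IsPrimeℤ -[1+ n ]  = ⊥

{-# OPTIONS --safe #-}
-- On a prime q, X(q) = 2q − 1, so as long as the iterates of p = m + 1 stay prime they are
-- the numbers 2^k·m + 1. For an odd prime p choose e ≥ 1 with 2^e ≡ 1 (mod p) (pigeonhole
-- on the residues of the powers of 2); then 2^e·m + 1 = 2^e·p − (2^e − 1) is a multiple of p
-- larger than p, hence not prime. For p = 2 the iterates are 3, 5, 9.
module Submission where

open import Defs
open import Data.Nat using (ℕ; zero; suc; _+_; _*_; _∸_; _^_; _≤_; _<_; _≥_; z≤n; s≤s; NonZero)
open import Data.Nat.Base using (n>1⇒nonTrivial)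
open import Data.Nat.Properties
open import Data.Nat.Divisibility
open import Data.Nat.DivMod using (_%_; _/_; m≡m%n+[m/n]*n; m%n<n)
open import Data.Nat.Primality
open import Data.Integer using (+_)
open import Data.Fin using (toℕ; fromℕ<)
open import Data.Fin.Properties using (pigeonhole; toℕ-fromℕ<)
open import Data.List using (filter; map; upTo; _++_; [_]; _∷_; [])
open import Data.List.Properties using (filter-accept; filter-reject; filter-++; map-++; upTo-∷ʳ)
open import Data.Product using (∃-syntax; _×_; _,_)
open import Data.Sum using (_⊎_; inj₁; inj₂)
open import Relation.Nullary using (¬_; ¬?; yes; no; contradiction)
open import Relation.Binary.PropositionalEquality hiding ([_])
open import Function using (_∘_)
open ≡-Reasoning

proper-divisor⇒¬prime : ∀ {d n} → 1 < d → d < n → d ∣ n → ¬ Prime n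
proper-divisor⇒¬prime 1<d d<n d∣n =
  composite⇒¬prime (hasNonTrivialDivisor {{n>1⇒nonTrivial 1<d}} d<n d∣n)

%-≡⇒∣∸ : ∀ a b n .{{_ : NonZero n}} → a % n ≡ b % n → n ∣ b ∸ a
%-≡⇒∣∸ a b n a%n≡b%n = divides (b / n ∸ a / n) (begin
    b ∸ a
  ≡⟨ cong₂ _∸_ (m≡m%n+[m/n]*n b n) (m≡m%n+[m/n]*n a n) ⟩
    (b % n + b / n * n) ∸ (a % n + a / n * n)
  ≡⟨ cong (λ r → (b % n + b / n * n) ∸ (r + a / n * n)) a%n≡b%n ⟩
    (b % n + b / n * n) ∸ (b % n + a / n * n)
  ≡⟨ [m+n]∸[m+o]≡n∸o (b % n) _ _ ⟩
    b / n * n ∸ a / n * n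
  ≡⟨ *-distribʳ-∸ n (b / n) (a / n) ⟨
    (b / n ∸ a / n) * n ∎)

^-∸-^ : ∀ a {i j} → i ≤ j → a ^ j ∸ a ^ i ≡ a ^ i * (a ^ (j ∸ i) ∸ 1)
^-∸-^ a {i} {j} i≤j = begin
    a ^ j ∸ a ^ i
  ≡⟨ cong (λ k → a ^ k ∸ a ^ i) (m+[n∸m]≡n i≤j) ⟨
    a ^ (i + (j ∸ i)) ∸ a ^ i
  ≡⟨ cong₂ _∸_ (^-distribˡ-+-* a i (j ∸ i)) (sym (*-identityʳ (a ^ i))) ⟩
    a ^ i * a ^ (j ∸ i) ∸ a ^ i * 1
  ≡⟨ *-distribˡ-∸ (a ^ i) (a ^ (j ∸ i)) 1 ⟨
    a ^ i * (a ^ (j ∸ i) ∸ 1) ∎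

prime∤⇒∤^ : ∀ {p a} → Prime p → ¬ p ∣ a → ∀ k → ¬ p ∣ a ^ k
prime∤⇒∤^ p-prime p∤a zero p∣1 = ¬prime[1] (subst Prime (∣1⇒≡1 p∣1) p-prime)
prime∤⇒∤^ p-prime p∤a (suc k) p∣a^k+1 with euclidsLemma _ _ p-prime p∣a^k+1
... | inj₁ p∣a   = p∤a p∣a
... | inj₂ p∣a^k = prime∤⇒∤^ p-prime p∤a k p∣a^k

∃-powers-≡-mod : ∀ a n .{{_ : NonZero n}} → ∃[ i ] ∃[ j ] (i < j × a ^ i % n ≡ a ^ j % n)
∃-powers-≡-mod a n
  with i , j , i<j , residues-equal ← pigeonhole (n<1+n n) (λ k → fromℕ< (m%n<n (a ^ toℕ k) n))
  = toℕ i , toℕ j , i<j , (begin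
      a ^ toℕ i % n  ≡⟨ toℕ-fromℕ< (m%n<n (a ^ toℕ i) n) ⟨
      toℕ _          ≡⟨ cong toℕ residues-equal ⟩
      toℕ _          ≡⟨ toℕ-fromℕ< (m%n<n (a ^ toℕ j) n) ⟩
      a ^ toℕ j % n  ∎)

∃-^≡1-mod-prime : ∀ {p a} → Prime p → ¬ p ∣ a → ∃[ e ] (1 ≤ e × p ∣ a ^ e ∸ 1)
∃-^≡1-mod-prime {p} {a} p-prime p∤a
  with i , j , i<j , a^i≡a^j ← ∃-powers-≡-mod a p {{prime⇒nonZero p-prime}}
  with euclidsLemma (a ^ i) _ p-prime
         (subst (p ∣_) (^-∸-^ a (<⇒≤ i<j)) (%-≡⇒∣∸ (a ^ i) (a ^ j) p {{prime⇒nonZero p-prime}} a^i≡a^j))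
... | inj₁ p∣a^i   = contradiction p∣a^i (prime∤⇒∤^ p-prime p∤a i)
... | inj₂ p∣a^e∸1 = j ∸ i , m<n⇒0<n∸m i<j , p∣a^e∸1

divisors-of-prime : ∀ {p} → Prime p → divisors p ≡ 1 ∷ p ∷ []
divisors-of-prime {suc (suc k)} p-prime =
  trans (filter-upTo-suc (suc k)) (cong₂ _++_ (proper-divisors k ≤-refl) (filter-accept (_∣? p) ∣-refl))
  where
  p = suc (suc k)

  filter-upTo-suc : ∀ n → filter (_∣? p) (map suc (upTo (suc n)))
                        ≡ filter (_∣? p) (map suc (upTo n)) ++ filter (_∣? p) [ suc n ]
  filter-upTo-suc n = begin
      filter (_∣? p) (map suc (upTo (suc n)))
    ≡⟨ cong (filter (_∣? p) ∘ map suc) (upTo-∷ʳ n) ⟨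
      filter (_∣? p) (map suc (upTo n ++ [ n ]))
    ≡⟨ cong (filter (_∣? p)) (map-++ suc (upTo n) [ n ]) ⟩
      filter (_∣? p) (map suc (upTo n) ++ [ suc n ])
    ≡⟨ filter-++ (_∣? p) (map suc (upTo n)) [ suc n ] ⟩
      filter (_∣? p) (map suc (upTo n)) ++ filter (_∣? p) [ suc n ] ∎

  proper-divisors : ∀ n → suc n < p → filter (_∣? p) (map suc (upTo (suc n))) ≡ [ 1 ]
  proper-divisors zero    _     = filter-accept (_∣? p) (1∣ p)
  proper-divisors (suc n) n+2<p = trans (filter-upTo-suc (suc n))
    (cong₂ _++_ (proper-divisors n (<-trans (n<1+n (suc n)) n+2<p))
                (filter-reject (_∣? p) λ n+2∣p → proper-divisor⇒¬prime (s≤s (s≤s z≤n)) n+2<p n+2∣p p-prime))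

X-prime : ∀ {m} → Prime (suc m) → X (suc m) ≡ + suc (m + m)
X-prime {m} p-prime rewrite divisors-of-prime p-prime
  | filter-accept prime? {xs = []} p-prime
  | filter-reject (¬? ∘ prime?) {xs = []} (λ ¬prime → ¬prime p-prime)
  = cong +_ (trans (cong (_+ suc m) (+-identityʳ m)) (+-suc m m))

orbit : ℕ → ℕ → ℕ
orbit m k = suc (2 ^ k * m)

X-orbit : ∀ m k → Prime (orbit m k) → X (orbit m k) ≡ + orbit m (suc k)
X-orbit m k orbit-prime = begin
    X (orbit m k)                         ≡⟨ X-prime orbit-prime ⟩
    + suc (2 ^ k * m + 2 ^ k * m)         ≡⟨ cong (λ n → + suc (2 ^ k * m + n)) (+-identityʳ (2 ^ k * m)) ⟨
    + suc (2 * (2 ^ k * m))               ≡⟨ cong (+_ ∘ suc) (*-assoc 2 (2 ^ k) m) ⟨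
    + orbit m (suc k)                     ∎

HasNonPrimeIterate : ℕ → Set
HasNonPrimeIterate p = ∃[ i ] (i ≥ 1 × ¬ IsPrimeℤ (iterate Xℤ i (+ p)))

nonprime-iterate : ∀ {p n} → Prime p → ∀ k → iterate Xℤ k (+ p) ≡ + n → ¬ Prime n →
  HasNonPrimeIterate p
nonprime-iterate p-prime zero    refl      ¬prime = contradiction p-prime ¬prime
nonprime-iterate _       (suc k) iterate≡n ¬prime =
  suc k , s≤s z≤n , λ prime → ¬prime (subst IsPrimeℤ iterate≡n prime)

iterate-follows-orbit : ∀ {m} → Prime (suc m) → ∀ k →
  HasNonPrimeIterate (suc m) ⊎ iterate Xℤ k (+ suc m) ≡ + orbit m k
iterate-follows-orbit {m} _ zero = inj₂ (cong (+_ ∘ suc) (sym (+-identityʳ m)))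
iterate-follows-orbit {m} p-prime (suc k) with iterate-follows-orbit p-prime k | prime? (orbit m k)
... | inj₁ escape        | _               = inj₁ escape
... | inj₂ iterate≡orbit | yes orbit-prime = inj₂ (trans (cong Xℤ iterate≡orbit) (X-orbit m k orbit-prime))
... | inj₂ iterate≡orbit | no ¬orbit-prime = inj₁ (nonprime-iterate p-prime k iterate≡orbit ¬orbit-prime)

nonprime-orbit⇒nonprime-iterate : ∀ {m} → Prime (suc m) → ∀ k → ¬ Prime (orbit m k) →
  HasNonPrimeIterate (suc m)
nonprime-orbit⇒nonprime-iterate p-prime k ¬orbit-prime with iterate-follows-orbit p-prime k
... | inj₁ escape        = escape
... | inj₂ iterate≡orbit = nonprime-iterate p-prime k iterate≡orbit ¬orbit-prime

[2^e∸1]+orbit≡2^e*[1+m] : ∀ m e → (2 ^ e ∸ 1) + orbit m e ≡ 2 ^ e * suc m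
[2^e∸1]+orbit≡2^e*[1+m] m e with 2 ^ e | m^n>0 2 e
... | suc x | _ = trans (+-suc x (suc x * m)) (sym (*-suc (suc x) m))

∣2^e∸1⇒∣orbit : ∀ m e → suc m ∣ 2 ^ e ∸ 1 → suc m ∣ orbit m e
∣2^e∸1⇒∣orbit m e p∣2^e∸1 =
  ∣m+n∣m⇒∣n (subst (suc m ∣_) (sym ([2^e∸1]+orbit≡2^e*[1+m] m e)) (n∣m*n (2 ^ e))) p∣2^e∸1

1+m<orbit : ∀ m .{{_ : NonZero m}} e → e ≥ 1 → suc m < orbit m e
1+m<orbit m e e≥1 = s≤s (<-≤-trans (m<m*n m (2 ^ e) (^-monoʳ-≤ 2 e≥1)) (≤-reflexive (*-comm m (2 ^ e))))

mainTheorem6 : (p : ℕ) → Prime p →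
    ∃[ i ] (i ≥ 1 × ¬ IsPrimeℤ (iterate Xℤ i (+ p)))
mainTheorem6 zero ()
mainTheorem6 (suc zero) ()
mainTheorem6 (suc (suc zero)) 2-prime =
  nonprime-orbit⇒nonprime-iterate 2-prime 3
    (proper-divisor⇒¬prime {3} (s≤s (s≤s z≤n)) (s≤s (s≤s (s≤s (s≤s z≤n)))) (divides 3 refl))
mainTheorem6 (suc m@(suc (suc _))) p-prime
  with e , e≥1 , p∣2^e∸1 ← ∃-^≡1-mod-prime p-prime (>⇒∤ (s≤s (s≤s (s≤s z≤n))))
  = nonprime-orbit⇒nonprime-iterate p-prime e
      (proper-divisor⇒¬prime (s≤s (s≤s z≤n)) (1+m<orbit m e e≥1) (∣2^e∸1⇒∣orbit m e p∣2^e∸1))
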